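{- Let $n\ge 3$ and let $W_n^\sigma$ be a distance compatible signed wheel. Then no set consisting of a single vertex is a resolving set of $W_n^\sigma$; that is, $\dim(W_n^\sigma)\ge 2$.
   Context: The wheel $W_n$ is the join of a cycle $C_n$ with $K_1$ (central vertex; the cycle vertices are rim vertices). A signed wheel is $W_n^\sigma=(W_n,\sigma)$ with $\sigma:E\to\{+1,-1\}$. The sign of a path is the product of its edge signs; the signed wheel is distance compatible if for all vertices $u,v$ all shortest $u$–$v$ paths have the same sign $\sigma(uv)$, and then $d_\Sigma(u,v)=\sigma(uv)d(u,v)$, $d$ the graph distance. For an ordered vertex set $W=(w_1,\dots,w_k)$, $r(v|W)=(d_\Sigma(v,w_1),\dots,d_\Sigma(v,w_k))$; $W$ is resolving if distinct vertices have distinct representations; $\dim$ is the minimum cardinality of a resolving set. -}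

module Defs where

open import Data.Nat using (ℕ; zero; suc; _≤_; _<?_; s≤s)
open import Data.Fin using (Fin; toℕ; fromℕ<)
import Data.Fin as F
open import Data.Sign using (Sign) renaming (_*_ to _*ₛ_)
import Data.Sign as S
open import Data.Integer using (ℤ; _◃_)
open import Data.List using (List)
open import Data.List.Relation.Unary.All using (All)
open import Data.Product using (Σ; ∃; _×_)
open import Relation.Nullary using (yes; no; ¬_)
open import Relation.Binary.PropositionalEquality using (_≡_)

next : ∀ {n} → Fin n → Fin n
next {suc n} i with suc (toℕ i) <? suc n
... | yes p = fromℕ< p
... | no _  = F.zero

data Vertex (n : ℕ) : Set where
  hub : Vertex n
  rim : Fin n → Vertex n

-- edges of W_n: spokes (hub–rim i) and rim edges (rim i – rim (i+1 mod n))
data Edge (n : ℕ) : Set where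
  spoke  : Fin n → Edge n
  rimEdge : Fin n → Edge n

-- adjacency (each undirected edge traversable in both directions)
data Adj {n : ℕ} : Vertex n → Vertex n → Set where
  out  : (i : Fin n) → Adj hub (rim i)
  into : (i : Fin n) → Adj (rim i) hub
  fwd  : (i : Fin n) → Adj (rim i) (rim (next i))
  bwd  : (i : Fin n) → Adj (rim (next i)) (rim i)

edgeOf : ∀ {n} {u v : Vertex n} → Adj u v → Edge n
edgeOf (out i)  = spoke i
edgeOf (into i) = spoke i
edgeOf (fwd i)  = rimEdge i
edgeOf (bwd i)  = rimEdge i

Signature : ℕ → Set
Signature n = Edge n → Sign

data Walk {n : ℕ} : Vertex n → Vertex n → Set where
  [] : ∀ {u} → Walk u u
  _∷_ : ∀ {u v w} → Adj u v → Walk v w → Walk u w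

length : ∀ {n} {u v : Vertex n} → Walk u v → ℕ
length []      = zero
length (_ ∷ p) = suc (length p)

sign : ∀ {n} → Signature n → {u v : Vertex n} → Walk u v → Sign
sign σ []      = S.+
sign σ (e ∷ p) = σ (edgeOf e) *ₛ sign σ p

-- p is a shortest u–v walk (hence a shortest path); its length is d(u,v)
Shortest : ∀ {n} {u v : Vertex n} → Walk u v → Set
Shortest {u = u} {v} p = (q : Walk u v) → length p ≤ length q

DistCompatible : ∀ {n} → Signature n → Set
DistCompatible {n} σ = ∀ (u v : Vertex n) (p q : Walk u v) →
  Shortest p → Shortest q → sign σ p ≡ sign σ q

-- SignedDist σ u v k : k = d_Σ(u,v) = σ(uv) d(u,v), witnessed by a shortest walk
SignedDist : ∀ {n} → Signature n → Vertex n → Vertex n → ℤ → Set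
SignedDist σ u v k = Σ (Walk u v) λ p → Shortest p × (k ≡ sign σ p ◃ length p)

SameRep : ∀ {n} → Signature n → List (Vertex n) → Vertex n → Vertex n → Set
SameRep σ W u v = All (λ w → ∃ λ k → SignedDist σ u w k × SignedDist σ v w k) W

Resolving : ∀ {n} → Signature n → List (Vertex n) → Set
Resolving {n} σ W = ∀ (u v : Vertex n) → SameRep σ W u v → u ≡ v

-- Every vertex w of W_n (n ≥ 3) has three distinct neighbours. Among the
-- signs of the three edges joining them to w, two agree, and the two
-- corresponding neighbours then both lie at signed distance ±1 from w with the
-- same sign, so the single vertex w cannot tell them apart.
module Submission where

open import Defs
open import Data.Nat using (ℕ; _≤_; suc; _<_; _<?_; s≤s; z≤n)
open import Data.Nat.Properties
  using (≤-antisym; ≤-pred; ≮⇒≥; <-irrefl; 1+n≢n; n<1+n; m<n⇒m<1+n)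
open import Data.Fin using (Fin; toℕ; fromℕ; inject₁)
import Data.Fin as F
open import Data.Fin.Properties using (toℕ-fromℕ<; toℕ-fromℕ; toℕ-inject₁; toℕ<n; toℕ-injective)
open import Data.Sign using (Sign)
import Data.Sign as S
open import Data.Integer using (_◃_)
open import Data.List using ([_])
open import Data.List.Relation.Unary.All using (_∷_; [])
open import Data.Product using (∃; _×_; _,_)
open import Data.Sum using (_⊎_; inj₁; inj₂)
open import Data.Empty using (⊥-elim)
open import Function using (_∘_)
open import Relation.Nullary using (¬_; yes; no)
open import Relation.Binary.PropositionalEquality using (_≡_; _≢_; refl; sym; trans; cong; subst)

toℕ-next : ∀ {n} (i : Fin (suc n)) →
  (toℕ (next i) ≡ suc (toℕ i) × suc (toℕ i) < suc n) ⊎ (toℕ (next i) ≡ 0 × toℕ i ≡ n)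
toℕ-next {n} i with suc (toℕ i) <? suc n
... | yes i+1<n = inj₁ (toℕ-fromℕ< i+1<n , i+1<n)
... | no  i+1≮n = inj₂ (refl , ≤-antisym (≤-pred (toℕ<n i)) (≤-pred (≮⇒≥ i+1≮n)))

next-surjective : ∀ {n} (i : Fin (suc n)) → ∃ λ j → next j ≡ i
next-surjective {n} F.zero with toℕ-next (fromℕ n)
... | inj₁ (_ , n+1<n+1) =
  ⊥-elim (<-irrefl refl (subst (λ k → suc k < suc n) (toℕ-fromℕ n) n+1<n+1))
... | inj₂ (next≡0 , _) = fromℕ n , toℕ-injective next≡0
next-surjective (F.suc i) with toℕ-next (inject₁ i)
... | inj₁ (next≡1+i , _) = inject₁ i , toℕ-injective (trans next≡1+i (cong suc (toℕ-inject₁ i)))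
... | inj₂ (_ , i≡n) = ⊥-elim (<-irrefl (trans (sym (toℕ-inject₁ i)) i≡n) (toℕ<n i))

i≢next[i] : ∀ {m} (i : Fin (suc (suc m))) → i ≢ next i
i≢next[i] i i≡next with toℕ-next i | cong toℕ i≡next
... | inj₁ (next≡1+i , _) | q = 1+n≢n (sym (trans q next≡1+i))
... | inj₂ (next≡0 , i≡1+m) | q with trans (sym i≡1+m) (trans q next≡0)
...   | ()

i≢next[next[i]] : ∀ {m} (i : Fin (suc (suc (suc m)))) → i ≢ next (next i)
i≢next[next[i]] i i≡next² with toℕ-next i | toℕ-next (next i) | cong toℕ i≡next²
... | inj₁ (e₁ , _) | inj₁ (e₂ , _) | q =
  <-irrefl (trans q (trans e₂ (cong suc e₁))) (m<n⇒m<1+n (n<1+n _))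
... | inj₁ (e₁ , _) | inj₂ (e₂ , f₂) | q with trans (sym f₂) (trans e₁ (cong suc (trans q e₂)))
...   | ()
i≢next[next[i]] i i≡next² | inj₂ (e₁ , f₁) | inj₁ (e₂ , _) | q
  with trans (sym f₁) (trans q (trans e₂ (cong suc e₁)))
...   | ()
i≢next[next[i]] i i≡next² | inj₂ (e₁ , _) | inj₂ (e₂ , f₂) | _ with trans (sym f₂) e₁
...   | ()

rim-injective : ∀ {n} {i j : Fin n} → rim i ≡ rim j → i ≡ j
rim-injective refl = refl

edge-shortest : ∀ {n} {u w : Vertex n} (e : Adj u w) → u ≢ w → Shortest (e ∷ [])
edge-shortest e u≢w []      = ⊥-elim (u≢w refl)
edge-shortest e u≢w (_ ∷ _) = s≤s z≤n

two-of-three-signs-agree : (a b c : Sign) → a ≡ b ⊎ a ≡ c ⊎ b ≡ c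
two-of-three-signs-agree S.- S.- _   = inj₁ refl
two-of-three-signs-agree S.- S.+ S.- = inj₂ (inj₁ refl)
two-of-three-signs-agree S.- S.+ S.+ = inj₂ (inj₂ refl)
two-of-three-signs-agree S.+ S.- S.- = inj₂ (inj₂ refl)
two-of-three-signs-agree S.+ S.- S.+ = inj₂ (inj₁ refl)
two-of-three-signs-agree S.+ S.+ _   = inj₁ refl

equally-signed-neighbours⇒¬Resolving :
  ∀ {n} (σ : Signature n) {u v w : Vertex n} (e : Adj u w) (f : Adj v w) →
  u ≢ w → v ≢ w → u ≢ v → σ (edgeOf e) ≡ σ (edgeOf f) → ¬ Resolving σ [ w ]
equally-signed-neighbours⇒¬Resolving σ {u} {v} e f u≢w v≢w u≢v σe≡σf resolving =
  u≢v (resolving u v ((_ , dist-u , dist-v) ∷ []))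
  where
  dist-u : SignedDist σ u _ (sign σ (e ∷ []) ◃ 1)
  dist-u = e ∷ [] , edge-shortest e u≢w , refl
  dist-v : SignedDist σ v _ (sign σ (e ∷ []) ◃ 1)
  dist-v = f ∷ [] , edge-shortest f v≢w , cong (λ s → (s S.* S.+) ◃ 1) σe≡σf

three-neighbours⇒¬Resolving :
  ∀ {n} (σ : Signature n) {a b c w : Vertex n} (e₁ : Adj a w) (e₂ : Adj b w) (e₃ : Adj c w) →
  a ≢ w → b ≢ w → c ≢ w → a ≢ b → a ≢ c → b ≢ c → ¬ Resolving σ [ w ]
three-neighbours⇒¬Resolving σ e₁ e₂ e₃ a≢w b≢w c≢w a≢b a≢c b≢c
  with two-of-three-signs-agree (σ (edgeOf e₁)) (σ (edgeOf e₂)) (σ (edgeOf e₃))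
... | inj₁ σ₁≡σ₂        = equally-signed-neighbours⇒¬Resolving σ e₁ e₂ a≢w b≢w a≢b σ₁≡σ₂
... | inj₂ (inj₁ σ₁≡σ₃) = equally-signed-neighbours⇒¬Resolving σ e₁ e₃ a≢w c≢w a≢c σ₁≡σ₃
... | inj₂ (inj₂ σ₂≡σ₃) = equally-signed-neighbours⇒¬Resolving σ e₂ e₃ b≢w c≢w b≢c σ₂≡σ₃

lemma3p3 : (n : ℕ) → 3 ≤ n → (σ : Signature n) → DistCompatible σ →
    (w : Vertex n) → ¬ Resolving σ [ w ]
lemma3p3 (suc (suc (suc m))) (s≤s (s≤s (s≤s z≤n))) σ _ hub =
  three-neighbours⇒¬Resolving σ (into F.zero) (into (F.suc F.zero)) (into (F.suc (F.suc F.zero)))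
    (λ ()) (λ ()) (λ ()) (λ ()) (λ ()) (λ ())
lemma3p3 (suc (suc (suc m))) (s≤s (s≤s (s≤s z≤n))) σ _ (rim i) with next-surjective i
... | j , refl =
  three-neighbours⇒¬Resolving σ (fwd j) (bwd (next j)) (out (next j))
    (i≢next[i] j ∘ rim-injective) (i≢next[i] (next j) ∘ sym ∘ rim-injective) (λ ())
    (i≢next[next[i]] j ∘ rim-injective) (λ ()) (λ ())
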